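{- Every sequent provable in $\mathsf{RTC}_{G}$ is provable in $\mathsf{NCRTC}^{\omega}_{G}$ (i.e. $\mathsf{NCRTC}^{\omega}_{G}\supseteq\mathsf{RTC}_{G}$).
   Context: Formulas of $\mathcal{L}_{\mathsf{RTC}}$: first-order formulas with equality extended by $(RTC_{x,y}\,\varphi)(s,t)$ for distinct variables $x,y$ bound in $\varphi$ and terms $s,t$. $\mathcal{LK}_=$: classical sequent calculus with axiom $\varphi\Rightarrow\varphi$, weakening, usual connective/quantifier rules (eigenvariable conditions), $(=L_1)$: from $\Gamma\Rightarrow\varphi[s/x],\Delta$ infer $\Gamma,s=t\Rightarrow\varphi[t/x],\Delta$, $(=L_2)$: from $\Gamma\Rightarrow\varphi[t/x],\Delta$ infer $\Gamma,s=t\Rightarrow\varphi[s/x],\Delta$, $(=R)$: $\Rightarrow t=t$, Cut, and (Subst): from $\Gamma\Rightarrow\Delta$ infer $\Gamma\theta\Rightarrow\Delta\theta$. Rules: (Refl) $\Gamma\Rightarrow\Delta,(RTC_{x,y}\varphi)(s,s)$; (Trans) from $\Gamma\Rightarrow\Delta,(RTC_{x,y}\varphi)(s,r)$ and $\Gamma\Rightarrow\Delta,\varphi[r/x,t/y]$ infer $\Gamma\Rightarrow\Delta,(RTC_{x,y}\varphi)(s,t)$; (Ind) from $\Gamma,\psi(x),\varphi(x,y)\Rightarrow\Delta,\psi[y/x]$ infer $\Gamma,\psi[s/x],(RTC_{x,y}\varphi)(s,t)\Rightarrow\Delta,\psi[t/x]$ with $x\notin fv(\Gamma,\Delta)$,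 $y\notin fv(\Gamma,\Delta,\psi)$; (Case) from $\Gamma,s=t\Rightarrow\Delta$ and $\Gamma,(RTC_{x,y}\varphi)(s,z),\varphi[z/x,t/y]\Rightarrow\Delta$ infer $\Gamma,(RTC_{x,y}\varphi)(s,t)\Rightarrow\Delta$, $z$ fresh, $(RTC_{x,y}\varphi)(s,z)$ being the immediate ancestor of the principal formula. $\mathsf{RTC}_G$ = $\mathcal{LK}_=$ + (Refl), (Trans), (Ind), with finite derivation trees as proofs. $\mathsf{RTC}^{\omega}_G$ = $\mathcal{LK}_=$ + (Refl), (Trans), (Case); a pre-proof is a possibly infinite derivation tree with no open leaves; a trace pair $(\tau,\tau')$ between $RTC$-formulas in the antecedents of a conclusion and a premise holds if the rule is (Subst) with $\tau=\tau'\theta$, or the rule is (Case) and $\tau$ is principal and $\tau'$ its immediate ancestor (progressing), or $\tau=\tau'$ otherwise; a trace follows a path if from some offset consecutive formulas are trace pairs along it; a proof is a pre-proof in which every infinite path is followed by a trace with infinitely many progressing pairs. A regular proof (finitely many distinct subtrees) is represented as a finite derivation tree some of whose leaves (buds) are each linked to an internal node (companion) labelled with the same sequent, giving a finite graph. A basic cycle in this graph is a path starting and ending at the same node with no other repeated nodes; two distinct basic cycles (not identical up to cyclic permutation) overlap if they share a node. $\mathsf{NCRTC}^{\omega}_G$ is the subsystem of $\mathsf{RTC}^{\omega}_G$ consisting of all and only the cyclic proofs that are non-overlapping, i.e. in which no two distinct basic cycles overlap. -}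

module Defs where

open import Data.Nat using (ℕ; zero; suc; _≤_; _<_)
open import Data.Fin using (Fin; zero; suc)
open import Data.Vec using (Vec; []; _∷_; lookup)
open import Data.List using (List; []; _∷_; _++_; [_]; map)
open import Data.List.Membership.Propositional using (_∈_)
open import Data.List.Relation.Binary.Subset.Propositional using (_⊆_)
open import Data.List.Relation.Unary.Linked using (Linked)
open import Data.List.Relation.Unary.Unique.Propositional using (Unique)
open import Data.Maybe using (Maybe; just; nothing)
open import Data.Product using (Σ; ∃; ∃₂; ∃-syntax; _×_; _,_)
open import Data.Sum using (_⊎_)
open import Data.Empty using (⊥)
open import Data.Unit using (⊤)
open import Relation.Nullary using (¬_)
open import Relation.Binary.PropositionalEquality using (_≡_; _≢_)

record Signature : Set₁ where
  field
    Fun       : Set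
    funArity  : Fun → ℕ
    Pred      : Set
    predArity : Pred → ℕ

module RTC (Sg : Signature) where
  open Signature Sg

  data Term : Set where
    var : ℕ → Term
    fun : (f : Fun) → Vec Term (funArity f) → Term

  mutual
    renT : (ℕ → ℕ) → Term → Term
    renT ρ (var x)    = var (ρ x)
    renT ρ (fun f ts) = fun f (renTs ρ ts)

    renTs : ∀ {k} → (ℕ → ℕ) → Vec Term k → Vec Term k
    renTs ρ []       = []
    renTs ρ (t ∷ ts) = renT ρ t ∷ renTs ρ ts

  Subst : Set
  Subst = ℕ → Term

  mutual
    subT : Subst → Term → Term
    subT σ (var x)    = σ x
    subT σ (fun f ts) = fun f (subTs σ ts)

    subTs : ∀ {k} → Subst → Vec Term k → Vec Term k
    subTs σ []       = []
    subTs σ (t ∷ ts) = subT σ t ∷ subTs σ ts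

  _∙_ : Term → Subst → Subst
  (t ∙ σ) zero    = t
  (t ∙ σ) (suc x) = σ x

  lift : Subst → Subst
  lift σ zero    = var zero
  lift σ (suc x) = renT suc (σ x)

  -- Formulas.  ∀' φ and ∃' φ bind variable 0 of φ.
  -- rtc φ s t is (RTC_{x,y} φ)(s,t): in φ, variable 1 is x and
  -- variable 0 is y (both bound); free variables of φ are shifted by 2.
  infix 8 _≐_
  infixr 7 _∧'_ _∨'_
  infixr 6 _⊃'_

  data Formula : Set where
    rel  : (P : Pred) → Vec Term (predArity P) → Formula
    _≐_  : Term → Term → Formula
    ¬'   : Formula → Formula
    _∧'_ : Formula → Formula → Formula
    _∨'_ : Formula → Formula → Formula
    _⊃'_ : Formula → Formula → Formula
    ∀'   : Formula → Formula
    ∃'   : Formula → Formula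
    rtc  : Formula → Term → Term → Formula

  subF : Subst → Formula → Formula
  subF σ (rel P ts)  = rel P (subTs σ ts)
  subF σ (s ≐ t)     = subT σ s ≐ subT σ t
  subF σ (¬' φ)      = ¬' (subF σ φ)
  subF σ (φ ∧' ψ)    = subF σ φ ∧' subF σ ψ
  subF σ (φ ∨' ψ)    = subF σ φ ∨' subF σ ψ
  subF σ (φ ⊃' ψ)    = subF σ φ ⊃' subF σ ψ
  subF σ (∀' φ)      = ∀' (subF (lift σ) φ)
  subF σ (∃' φ)      = ∃' (subF (lift σ) φ)
  subF σ (rtc φ s t) = rtc (subF (lift (lift σ)) φ) (subT σ s) (subT σ t)

  shiftT : Term → Term
  shiftT = renT suc

  shiftF : Formula → Formula
  shiftF = subF (λ x → var (suc x))

  shift2F : Formula → Formula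
  shift2F = subF (λ x → var (suc (suc x)))

  _⟨_⟩ : Formula → Term → Formula
  φ ⟨ t ⟩ = subF (t ∙ var) φ

  -- φ[r/x, t/y] for the body φ of an RTC-formula
  inst2 : Formula → Term → Term → Formula
  inst2 φ r t = subF (t ∙ (r ∙ var)) φ

  -- Sequents (antecedent and succedent read as finite sets)

  infix 2 _⇒_

  record Sequent : Set where
    constructor _⇒_
    field
      ante : List Formula
      succ : List Formula
  open Sequent public

  -- Ind premise ingredients (context extended by fresh x = 1, y = 0)
  ψ-at-x : Formula → Formula
  ψ-at-x ψ = subF (var 1 ∙ (λ k → var (suc (suc k)))) ψ

  ψ-at-y : Formula → Formula
  ψ-at-y ψ = subF (var 0 ∙ (λ k → var (suc (suc k)))) ψ

  -- Case premise ingredients (context extended by fresh z = 0)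
  -- (RTC φ)(s,z) in the extended context
  caseAnc : Formula → Term → Formula
  caseAnc φ s = rtc (subF (lift (lift (λ x → var (suc x)))) φ) (shiftT s) (var 0)

  -- φ[z/x, t/y] in the extended context
  caseStep : Formula → Term → Formula
  caseStep φ t = subF (shiftT t ∙ (var 0 ∙ (λ k → var (suc k)))) φ

  -- Rules.  fin = RTC_G (with Ind), cyc = RTC^ω_G (with Case).

  data Sys : Set where
    fin cyc : Sys

  data Rule : Sys → ∀ {k} → Sequent → Vec Sequent k → Set where
    axiom : ∀ {sys} φ → Rule sys ([ φ ] ⇒ [ φ ]) []
    weak  : ∀ {sys Γ Δ Γ' Δ'} → Γ ⊆ Γ' → Δ ⊆ Δ' →
            Rule sys (Γ' ⇒ Δ') ((Γ ⇒ Δ) ∷ [])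
    ¬L : ∀ {sys Γ Δ φ} → Rule sys (¬' φ ∷ Γ ⇒ Δ) ((Γ ⇒ φ ∷ Δ) ∷ [])
    ¬R : ∀ {sys Γ Δ φ} → Rule sys (Γ ⇒ ¬' φ ∷ Δ) ((φ ∷ Γ ⇒ Δ) ∷ [])
    ∧L : ∀ {sys Γ Δ φ ψ} → Rule sys (φ ∧' ψ ∷ Γ ⇒ Δ) ((φ ∷ ψ ∷ Γ ⇒ Δ) ∷ [])
    ∧R : ∀ {sys Γ Δ φ ψ} → Rule sys (Γ ⇒ φ ∧' ψ ∷ Δ)
                                ((Γ ⇒ φ ∷ Δ) ∷ (Γ ⇒ ψ ∷ Δ) ∷ [])
    ∨L : ∀ {sys Γ Δ φ ψ} → Rule sys (φ ∨' ψ ∷ Γ ⇒ Δ)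
                                ((φ ∷ Γ ⇒ Δ) ∷ (ψ ∷ Γ ⇒ Δ) ∷ [])
    ∨R : ∀ {sys Γ Δ φ ψ} → Rule sys (Γ ⇒ φ ∨' ψ ∷ Δ) ((Γ ⇒ φ ∷ ψ ∷ Δ) ∷ [])
    ⊃L : ∀ {sys Γ Δ φ ψ} → Rule sys (φ ⊃' ψ ∷ Γ ⇒ Δ)
                                ((Γ ⇒ φ ∷ Δ) ∷ (ψ ∷ Γ ⇒ Δ) ∷ [])
    ⊃R : ∀ {sys Γ Δ φ ψ} → Rule sys (Γ ⇒ φ ⊃' ψ ∷ Δ) ((φ ∷ Γ ⇒ ψ ∷ Δ) ∷ [])
    ∀L : ∀ {sys Γ Δ φ} (t : Term) → Rule sys (∀' φ ∷ Γ ⇒ Δ) ((φ ⟨ t ⟩ ∷ Γ ⇒ Δ) ∷ [])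
    -- eigenvariable = the fresh de Bruijn variable 0
    ∀R : ∀ {sys Γ Δ φ} → Rule sys (Γ ⇒ ∀' φ ∷ Δ)
                              ((map shiftF Γ ⇒ φ ∷ map shiftF Δ) ∷ [])
    ∃L : ∀ {sys Γ Δ φ} → Rule sys (∃' φ ∷ Γ ⇒ Δ)
                              ((φ ∷ map shiftF Γ ⇒ map shiftF Δ) ∷ [])
    ∃R : ∀ {sys Γ Δ φ} (t : Term) → Rule sys (Γ ⇒ ∃' φ ∷ Δ) ((Γ ⇒ φ ⟨ t ⟩ ∷ Δ) ∷ [])
    =L₁ : ∀ {sys Γ Δ φ s t} → Rule sys (s ≐ t ∷ Γ ⇒ φ ⟨ t ⟩ ∷ Δ) ((Γ ⇒ φ ⟨ s ⟩ ∷ Δ) ∷ [])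
    =L₂ : ∀ {sys Γ Δ φ s t} → Rule sys (s ≐ t ∷ Γ ⇒ φ ⟨ s ⟩ ∷ Δ) ((Γ ⇒ φ ⟨ t ⟩ ∷ Δ) ∷ [])
    =R  : ∀ {sys} t → Rule sys ([] ⇒ [ t ≐ t ]) []
    cut : ∀ {sys Γ Δ φ} → Rule sys (Γ ⇒ Δ) ((Γ ⇒ φ ∷ Δ) ∷ (φ ∷ Γ ⇒ Δ) ∷ [])
    sub : ∀ {sys Γ Δ} (θ : Subst) →
          Rule sys (map (subF θ) Γ ⇒ map (subF θ) Δ) ((Γ ⇒ Δ) ∷ [])
    rtc-refl  : ∀ {sys Γ Δ φ s} → Rule sys (Γ ⇒ rtc φ s s ∷ Δ) []
    rtc-trans : ∀ {sys Γ Δ φ s r t} → Rule sys (Γ ⇒ rtc φ s t ∷ Δ)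
                  ((Γ ⇒ rtc φ s r ∷ Δ) ∷ (Γ ⇒ inst2 φ r t ∷ Δ) ∷ [])
    rtc-ind  : ∀ {Γ Δ ψ φ s t} →
               Rule fin (ψ ⟨ s ⟩ ∷ rtc φ s t ∷ Γ ⇒ ψ ⟨ t ⟩ ∷ Δ)
                 ((φ ∷ ψ-at-x ψ ∷ map shift2F Γ ⇒ ψ-at-y ψ ∷ map shift2F Δ) ∷ [])
    rtc-case : ∀ {Γ Δ φ s t} →
               Rule cyc (rtc φ s t ∷ Γ ⇒ Δ)
                 ((s ≐ t ∷ Γ ⇒ Δ) ∷
                  (caseAnc φ s ∷ caseStep φ t ∷ map shiftF Γ ⇒ map shiftF Δ) ∷ [])

  data ProvG : Sequent → Set where
    by : ∀ {S k} {Ps : Vec Sequent k} → Rule fin S Ps →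
         ((i : Fin k) → ProvG (lookup Ps i)) → ProvG S

  IsRTC : Formula → Set
  IsRTC (rtc _ _ _) = ⊤
  IsRTC _           = ⊥

  -- "τ = τ'" (modulo the de Bruijn shift of the premise context),
  -- or τ = τ'θ for (Subst)
  plainRel : ∀ {sys k S} {Ps : Vec Sequent k} →
             Rule sys S Ps → Fin k → Formula → Formula → Set
  plainRel (sub θ) _ τ τ'      = τ ≡ subF θ τ'
  plainRel ∀R _ τ τ'           = τ' ≡ shiftF τ
  plainRel ∃L _ τ τ'           = τ' ≡ shiftF τ
  plainRel rtc-ind _ τ τ'      = τ' ≡ shift2F τ
  plainRel rtc-case zero τ τ'  = τ' ≡ τ
  plainRel rtc-case (suc _) τ τ' = τ' ≡ shiftF τ
  plainRel _ _ τ τ'            = τ' ≡ τ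

  -- progressing: (Case), τ principal, τ' its immediate ancestor
  progRel : ∀ {sys k S} {Ps : Vec Sequent k} →
            Rule sys S Ps → Fin k → Formula → Formula → Set
  progRel (rtc-case {φ = φ} {s = s} {t = t}) (suc zero) τ τ' =
    (τ ≡ rtc φ s t) × (τ' ≡ caseAnc φ s)
  progRel _ _ _ _ = ⊥

  PlainPair : ∀ {sys k S} {Ps : Vec Sequent k} →
              Rule sys S Ps → Fin k → Formula → Formula → Set
  PlainPair {S = S} {Ps = Ps} r i τ τ' =
    IsRTC τ × IsRTC τ' × τ ∈ ante S × τ' ∈ ante (lookup Ps i) × plainRel r i τ τ'

  ProgPair : ∀ {sys k S} {Ps : Vec Sequent k} →
             Rule sys S Ps → Fin k → Formula → Formula → Set
  ProgPair {S = S} {Ps = Ps} r i τ τ' =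
    IsRTC τ × IsRTC τ' × τ ∈ ante S × τ' ∈ ante (lookup Ps i) × progRel r i τ τ'

  TracePair : ∀ {sys k S} {Ps : Vec Sequent k} →
              Rule sys S Ps → Fin k → Formula → Formula → Set
  TracePair r i τ τ' = PlainPair r i τ τ' ⊎ ProgPair r i τ τ'

  -- Cyclic (regular) RTC^ω_G pre-proofs, represented as a finite
  -- derivation tree (nodes Fin size) with buds linked to companions.

  data NodeKind (n : ℕ) (seq : Fin n → Sequent) (v : Fin n) : Set where
    bud   : (c : Fin n) → seq c ≡ seq v → NodeKind n seq v
    inner : ∀ {k} {Ps : Vec Sequent k} → Rule cyc (seq v) Ps →
            (cs : Vec (Fin n) k) → (∀ i → seq (lookup cs i) ≡ lookup Ps i) →
            NodeKind n seq v

  module _ {n : ℕ} {seq : Fin n → Sequent} {v : Fin n} where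
    nkArity : NodeKind n seq v → ℕ
    nkArity (bud _ _)           = 0
    nkArity (inner {k} _ _ _)   = k

    nkChild : (x : NodeKind n seq v) → Fin (nkArity x) → Fin n
    nkChild (inner _ cs _) i = lookup cs i

    nkBud : NodeKind n seq v → Maybe (Fin n)
    nkBud (bud c _)       = just c
    nkBud (inner _ _ _)   = nothing

    -- the node a child edge leads to in the unfolding
    nkResolve : NodeKind n seq v → Fin n
    nkResolve (bud c _)     = c
    nkResolve (inner _ _ _) = v

    nkTrace : (x : NodeKind n seq v) → Fin (nkArity x) → Formula → Formula → Set
    nkTrace (inner r _ _) i τ τ' = TracePair r i τ τ'

    nkProg : (x : NodeKind n seq v) → Fin (nkArity x) → Formula → Formula → Set
    nkProg (inner r _ _) i τ τ' = ProgPair r i τ τ'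

  record Preproof : Set where
    field
      size : ℕ
      seq  : Fin size → Sequent
      kind : (v : Fin size) → NodeKind size seq v
      root : Fin size

  module _ (P : Preproof) where
    open Preproof P

    arity : Fin size → ℕ
    arity v = nkArity (kind v)

    child : (v : Fin size) → Fin (arity v) → Fin size
    child v i = nkChild (kind v) i

    budOf : Fin size → Maybe (Fin size)
    budOf v = nkBud (kind v)

    resolve : Fin size → Fin size
    resolve w = nkResolve (kind w)

    -- the child structure is a finite tree rooted at root; companions
    -- are internal (non-bud) nodes
    record WellFormed : Set where
      field
        root-orphan   : ∀ v i → child v i ≢ root
        has-parent    : ∀ w → w ≢ root → ∃[ v ] Σ (Fin (arity v)) λ i → child v i ≡ w
        parent-unique : ∀ v i v' i' → child v i ≡ child v' i' →
                        _≡_ {A = Σ (Fin size) (λ u → Fin (arity u))} (v , i) (v' , i')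
        rank          : Fin size → ℕ
        rank-child    : ∀ v i → rank v < rank (child v i)
        companion-inner : ∀ v c → budOf v ≡ just c → budOf c ≡ nothing

    record InfPath : Set where
      field
        node  : ℕ → Fin size
        dir   : (j : ℕ) → Fin (arity (node j))
        start : node 0 ≡ root
        next  : ∀ j → node (suc j) ≡ resolve (child (node j) (dir j))

    GoodTrace : InfPath → Set
    GoodTrace π =
      Σ (ℕ → Formula) λ τ → Σ ℕ λ m →
        (∀ j → m ≤ j → nkTrace (kind (node j)) (dir j) (τ j) (τ (suc j))) ×
        (∀ j → Σ ℕ λ j' → j ≤ j' × m ≤ j' ×
                 nkProg (kind (node j')) (dir j') (τ j') (τ (suc j')))
      where open InfPath π

    -- global trace condition (classical existence, stated as ¬¬)
    GlobalTrace : Set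
    GlobalTrace = (π : InfPath) → ¬ ¬ GoodTrace π

    Edge : Fin size → Fin size → Set
    Edge v w = (Σ (Fin (arity v)) λ i → child v i ≡ w) ⊎ (budOf v ≡ just w)

    BasicCycle : List (Fin size) → Set
    BasicCycle []       = ⊥
    BasicCycle (v ∷ vs) = Linked Edge (v ∷ vs ++ v ∷ []) × Unique (v ∷ vs)

    SameUpToRotation : List (Fin size) → List (Fin size) → Set
    SameUpToRotation c c' = ∃₂ λ xs ys → c ≡ xs ++ ys × c' ≡ ys ++ xs

    NonOverlapping : Set
    NonOverlapping = ∀ c c' → BasicCycle c → BasicCycle c' →
                     (∃ λ v → v ∈ c × v ∈ c') → SameUpToRotation c c'

  ProvNC : Sequent → Set
  ProvNC S = Σ Preproof λ P →
    Preproof.seq P (Preproof.root P) ≡ S ×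
    WellFormed P × GlobalTrace P × NonOverlapping P

-- Each (Ind) inference is replaced by a cyclic gadget.  In a context with a fresh z, the
-- companion (RTC φ)(s,z), ψ(s), Γ ⇒ ψ(z), Δ is Case-split on (RTC φ)(s,z): the branch
-- s = z closes by an axiom, and the step branch (RTC φ)(s,z'), φ(z',z) cuts on ψ(z'),
-- getting ψ(z') from a substitution instance of the companion itself (a bud) and ψ(z)
-- from the Ind premise instantiated at x,y := z',z.  Substituting t for z gives the
-- conclusion of (Ind).
--
-- Both correctness conditions follow from a level on nodes that never decreases along
-- an edge and stays constant only around the gadget loops, on which the level-preserving
-- edges are functional.  An infinite path therefore ends up circling a single loop, where
-- (RTC φ)(s,z) yields a trace progressing at every Case step; and a basic cycle lies on
-- one level, so it is the unique orbit through any of its nodes and cannot overlap another.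

module Submission where

open import Defs

open import Data.Nat using (ℕ; zero; suc; _+_; _∸_; _≤_; _<_; _≤′_; ≤′-refl; ≤′-step; z≤n; s≤s)
open import Data.Nat.Induction using (<-wellFounded)
open import Data.Nat.Properties
  using (≤-refl; ≤-trans; ≤-antisym; ≤-reflexive; <-irrefl; ≮⇒≥; ∸-monoʳ-<; ≤⇒≤′; n≤1+n; m≤m+n; m≤n+m;
         _≤?_; suc-injective; +-cancelˡ-≡; +-mono-≤; +-monoʳ-≤; +-monoʳ-<; n≮0)
open import Data.Fin using (Fin; zero; suc; _↑ˡ_; _↑ʳ_; splitAt)
open import Data.Fin.Properties using (¬Fin0; splitAt-↑ˡ; splitAt-↑ʳ; splitAt⁻¹-↑ˡ; splitAt⁻¹-↑ʳ; all?)
open import Data.Vec using (Vec; []; _∷_; lookup; tabulate)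
open import Data.Vec.Properties using (lookup∘tabulate)
open import Data.List using (List; []; _∷_; _++_; [_]; map)
open import Data.List.Properties using (++-assoc; ++-identityʳ; ∷-injective)
open import Data.List.Membership.Propositional using (_∈_; _∉_)
open import Data.List.Membership.Propositional.Properties using (∈-++⁻; ∈-++⁺ˡ; ∈-++⁺ʳ; ∈-∃++)
open import Data.List.Relation.Unary.Any using (here; there)
open import Data.List.Relation.Unary.All as All using ()
open import Data.List.Relation.Unary.AllPairs using (_∷_)
open import Data.List.Relation.Unary.Linked using (Linked; [-]; _∷_)
open import Data.List.Relation.Unary.Unique.Propositional using (Unique)
open import Data.List.Relation.Binary.Subset.Propositional.Properties
  using (⊆-reflexive; ⊆-trans; ⊆-reflexive-↭; ∷⁺ʳ; xs⊆x∷xs; ∈-∷⁺ʳ)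
open import Data.List.Relation.Binary.Permutation.Propositional using (swap; ↭-refl)
open import Data.Maybe as Maybe using (Maybe; just; nothing)
open import Data.Maybe.Properties using (just-injective)
open import Data.Product using (Σ; ∃₂; ∃-syntax; _×_; _,_; proj₁; proj₂)
open import Data.Sum using (_⊎_; inj₁; inj₂; [_,_]′)
open import Data.Empty using (⊥; ⊥-elim)
open import Data.Unit using (⊤; tt)
open import Function using (_∘_; id)
open import Induction.WellFounded using (Acc; acc)
open import Level using () renaming (zero to ℓ₀)
open import Relation.Binary.Core using (Rel)
open import Relation.Nullary using (¬_; yes; no)
open import Relation.Nullary.Decidable using (True; toWitness; ¬¬-excluded-middle)
open import Relation.Binary.PropositionalEquality
  using (_≡_; _≢_; _≗_; refl; sym; trans; cong; cong₂; subst; subst₂)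

module BoundedMonotone
  (h : ℕ → ℕ) (bound : ℕ) (h-step : ∀ j → h j ≤ h (suc j)) (h-bounded : ∀ j → h j ≤ bound) where

  h-mono : ∀ {k j} → k ≤′ j → h k ≤ h j
  h-mono ≤′-refl        = ≤-refl
  h-mono (≤′-step k≤j) = ≤-trans (h-mono k≤j) (h-step _)

  EventuallyConstant : Set
  EventuallyConstant = ∃[ m ] ∀ j → m ≤ j → h j ≡ h m

  -- Each strict increase of h lowers bound ∸ h, which cannot go on forever.
  eventuallyConstant : ¬ ¬ EventuallyConstant
  eventuallyConstant = from 0 (<-wellFounded (bound ∸ h 0))
    where
    from : ∀ k → Acc _<_ (bound ∸ h k) → ¬ ¬ EventuallyConstant
    from k (acc rec) notEC = ¬¬-excluded-middle {A = ∃[ j ] k ≤ j × h k < h j} λ where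
      (yes (j , _ , hk<hj)) → from j (rec (∸-monoʳ-< hk<hj (h-bounded j))) notEC
      (no noRise) → notEC (k , λ j k≤j →
        ≤-antisym (≮⇒≥ λ hk<hj → noRise (j , k≤j , hk<hj)) (h-mono (≤⇒≤′ k≤j)))

module _ {A : Set} where

  ++-≡-++ : ∀ (xs ys xs' ys' : List A) → xs ++ ys ≡ xs' ++ ys' →
            (∃[ m ] xs ≡ xs' ++ m × ys' ≡ m ++ ys) ⊎ (∃[ m ] xs' ≡ xs ++ m × ys ≡ m ++ ys')
  ++-≡-++ []       ys xs'       ys' e  = inj₂ (xs' , refl , e)
  ++-≡-++ (x ∷ xs) ys []        ys' e  = inj₁ (x ∷ xs , refl , sym e)
  ++-≡-++ (x ∷ xs) ys (_ ∷ xs') ys' e with ∷-injective e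
  ... | refl , e′ with ++-≡-++ xs ys xs' ys' e′
  ...   | inj₁ (m , refl , e″) = inj₁ (m , refl , e″)
  ...   | inj₂ (m , refl , e″) = inj₂ (m , refl , e″)

  Rotation : List A → List A → Set
  Rotation c c' = ∃₂ λ xs ys → c ≡ xs ++ ys × c' ≡ ys ++ xs

  rotation-by-common-rotation : ∀ xs ys xs' ys' → ys ++ xs ≡ ys' ++ xs' → Rotation (xs ++ ys) (xs' ++ ys')
  rotation-by-common-rotation xs ys xs' ys' e with ++-≡-++ ys xs ys' xs' e
  ... | inj₁ (m , refl , refl) = xs ++ ys' , m , sym (++-assoc xs ys' m) , ++-assoc m xs ys'
  ... | inj₂ (m , refl , refl) = m , xs' ++ ys , ++-assoc m xs' ys , sym (++-assoc xs' ys m)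

  unique-middle : ∀ xs {u ys} → Unique {A = A} (xs ++ u ∷ ys) → u ∉ xs ++ ys
  unique-middle []       (u∉ ∷ _)    u∈          = All.lookup u∉ u∈ refl
  unique-middle (x ∷ xs) (x∉ ∷ _)    (here refl) = All.lookup x∉ (∈-++⁺ʳ xs (here refl)) refl
  unique-middle (x ∷ xs) (_ ∷ uniq)  (there u∈)  = unique-middle xs uniq u∈

  ∉-++-comm : ∀ xs {ys} {u : A} → u ∉ xs ++ ys → u ∉ ys ++ xs
  ∉-++-comm xs {ys} u∉ u∈ with ∈-++⁻ ys u∈
  ... | inj₁ u∈ys = u∉ (∈-++⁺ʳ xs u∈ys)
  ... | inj₂ u∈xs = u∉ (∈-++⁺ˡ u∈xs)

  module _ {ℓ} {R : Rel A ℓ} where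

    Linked-split : ∀ xs {y ys} → Linked R (xs ++ y ∷ ys) → Linked R (xs ++ [ y ]) × Linked R (y ∷ ys)
    Linked-split []            rs       = [-] , rs
    Linked-split (_ ∷ [])      (r ∷ rs) = r ∷ [-] , rs
    Linked-split (_ ∷ x ∷ xs)  (r ∷ rs) with Linked-split (x ∷ xs) rs
    ... | front , back = r ∷ front , back

    Linked-join : ∀ xs {y ys} → Linked R (xs ++ [ y ]) → Linked R (y ∷ ys) → Linked R (xs ++ y ∷ ys)
    Linked-join []           _               rs   = rs
    Linked-join (_ ∷ [])     (r ∷ [-])       rs   = r ∷ rs
    Linked-join (_ ∷ x ∷ xs) (r ∷ front)     back = r ∷ Linked-join (x ∷ xs) front back

    closedWalk-rotate : ∀ x xs {u ys} → Linked R (x ∷ xs ++ u ∷ ys ++ [ x ]) → Linked R (u ∷ ys ++ x ∷ xs ++ [ u ])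
    closedWalk-rotate x xs walk with Linked-split (x ∷ xs) walk
    ... | toU , fromU = Linked-join (_ ∷ _) fromU toU

module CyclesByLevels {A : Set} (R : Rel A ℓ₀) (level : A → ℕ)
  (level-mono : ∀ {v w} → R v w → level v ≤ level w)
  (flat-functional : ∀ {v w w'} → R v w → R v w' → level v ≡ level w → level v ≡ level w' → w ≡ w') where

  Flat : Rel A ℓ₀
  Flat v w = R v w × level v ≡ level w

  walk-level-≤ : ∀ l {x z} → Linked R (x ∷ l ++ [ z ]) → level x ≤ level z
  walk-level-≤ []      (r ∷ [-]) = level-mono r
  walk-level-≤ (_ ∷ l) (r ∷ rs)  = ≤-trans (level-mono r) (walk-level-≤ l rs)

  walk-flat : ∀ l {x z} → Linked R (x ∷ l ++ [ z ]) → level z ≤ level x → Linked Flat (x ∷ l ++ [ z ])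
  walk-flat []      (r ∷ [-]) z≤x = (r , ≤-antisym (level-mono r) z≤x) ∷ [-]
  walk-flat (_ ∷ l) (r ∷ rs)  z≤x =
    (r , ≤-antisym (level-mono r) (≤-trans (walk-level-≤ l rs) z≤x)) ∷ walk-flat l rs (≤-trans z≤x (level-mono r))

  flat-walks-unique : ∀ {x u} l l' → Linked Flat (x ∷ l ++ [ u ]) → Linked Flat (x ∷ l' ++ [ u ]) →
                      u ∉ l → u ∉ l' → l ≡ l'
  flat-walks-unique []      []       _              _                _    _     = refl
  flat-walks-unique []      (_ ∷ _)  ((r , e) ∷ _)  ((r' , e') ∷ _)  _    u∉l'  =
    ⊥-elim (u∉l' (here (flat-functional r r' e e')))
  flat-walks-unique (_ ∷ _) []       ((r , e) ∷ _)  ((r' , e') ∷ _)  u∉l  _     =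
    ⊥-elim (u∉l (here (flat-functional r' r e' e)))
  flat-walks-unique (y ∷ l) (_ ∷ l') ((r , e) ∷ rs) ((r' , e') ∷ rs') u∉l u∉l' with flat-functional r r' e e'
  ... | refl = cong (y ∷_) (flat-walks-unique l l' rs rs' (u∉l ∘ there) (u∉l' ∘ there))

  RotationAt : List A → A → Set
  RotationAt c u = ∃₂ λ xs ys → c ≡ xs ++ u ∷ ys × Linked Flat (u ∷ (ys ++ xs) ++ [ u ]) × u ∉ ys ++ xs

  rotationAt : ∀ {v vs u} → Linked R (v ∷ vs ++ [ v ]) → Unique (v ∷ vs) → u ∈ v ∷ vs → RotationAt (v ∷ vs) u
  rotationAt {v} {vs} walk uniq u∈ with ∈-∃++ u∈ | walk-flat vs walk ≤-refl
  ... | [] , ys , refl | flat =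
    [] , ys , refl , subst (λ l → Linked Flat (v ∷ l ++ [ v ])) (sym (++-identityʳ ys)) flat ,
    ∉-++-comm [] (unique-middle [] uniq)
  ... | x ∷ xs , ys , refl | flat =
    x ∷ xs , ys , refl ,
    subst (λ l → Linked Flat (_ ∷ l)) (sym (++-assoc ys (x ∷ xs) _))
      (closedWalk-rotate x xs (subst (λ l → Linked Flat (x ∷ l)) (++-assoc xs (_ ∷ ys) _) flat)) ,
    ∉-++-comm (x ∷ xs) (unique-middle (x ∷ xs) uniq)

  cycles-through-common-node : ∀ {v vs v' vs' u} →
    Linked R (v ∷ vs ++ [ v ]) → Unique (v ∷ vs) → Linked R (v' ∷ vs' ++ [ v' ]) → Unique (v' ∷ vs') →
    u ∈ v ∷ vs → u ∈ v' ∷ vs' → Rotation (v ∷ vs) (v' ∷ vs')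
  cycles-through-common-node walk uniq walk' uniq' u∈ u∈'
    with rotationAt walk uniq u∈ | rotationAt walk' uniq' u∈'
  ... | xs , ys , c≡ , flat , u∉ | xs' , ys' , c'≡ , flat' , u∉' =
    subst₂ Rotation (sym c≡) (sym c'≡) (rotation-by-common-rotation xs _ xs' _
      (cong (_ ∷_) (flat-walks-unique (ys ++ xs) (ys' ++ xs') flat flat' u∉ u∉')))

module LevelCriteria (Sg : Signature) (P : RTC.Preproof Sg) where
  open RTC Sg
  open Preproof P

  nonOverlapping-by-levels : (level : Fin size → ℕ) →
    (∀ {v w} → Edge P v w → level v ≤ level w) →
    (∀ {v w w'} → Edge P v w → Edge P v w' → level v ≡ level w → level v ≡ level w' → w ≡ w') →
    NonOverlapping P
  nonOverlapping-by-levels level mono functional (_ ∷ _) (_ ∷ _) (walk , uniq) (walk' , uniq') (_ , u∈ , u∈') =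
    cycles-through-common-node walk uniq walk' uniq' u∈ u∈'
    where open CyclesByLevels (Edge P) level mono functional

  module _ (level descent : Fin size → ℕ) (traced : Fin size → Formula) where

    FlatStep : (v : Fin size) → Fin (arity P v) → Fin size → Set
    FlatStep v i w = level v ≡ level w
                   × nkTrace (kind v) i (traced v) (traced w)
                   × (nkProg (kind v) i (traced v) (traced w) ⊎ descent w < descent v)

    TraceStep : (v : Fin size) → Fin (arity P v) → Set
    TraceStep v i = level v < level w ⊎ FlatStep v i w
      where
      w : Fin size
      w = resolve P (child P v i)

    globalTrace-by-levels : (bound : ℕ) → (∀ v → level v ≤ bound) →
                            (∀ v i → TraceStep v i) → GlobalTrace P
    globalTrace-by-levels bound bounded step π notGood =
      eventuallyConstant λ (m , const) → notGood (goodTrace m const)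
      where
      open InfPath π
      h : ℕ → ℕ
      h j = level (node j)

      stepAt : ∀ j → h j < h (suc j) ⊎ FlatStep (node j) (dir j) (node (suc j))
      stepAt j = subst (λ w → h j < level w ⊎ FlatStep (node j) (dir j) w)
                       (sym (next j)) (step (node j) (dir j))

      h-step : ∀ j → h j ≤ h (suc j)
      h-step j with stepAt j
      ... | inj₁ rise            = ≤-trans (n≤1+n _) rise
      ... | inj₂ (same , _ , _)  = ≤-reflexive same

      open BoundedMonotone h bound h-step (λ j → bounded (node j))

      goodTrace : ∀ m → (∀ j → m ≤ j → h j ≡ h m) → GoodTrace P π
      goodTrace m const = (λ j → traced (node j)) , m , traceAt , progressAfter
        where
        flatAt : ∀ j → m ≤ j → FlatStep (node j) (dir j) (node (suc j))
        flatAt j m≤j with stepAt j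
        ... | inj₂ flat = flat
        ... | inj₁ rise = ⊥-elim (<-irrefl (trans (const j m≤j) (sym (const (suc j) (≤-trans m≤j (n≤1+n j))))) rise)

        traceAt : ∀ j → m ≤ j → nkTrace (kind (node j)) (dir j) (traced (node j)) (traced (node (suc j)))
        traceAt j m≤j = proj₁ (proj₂ (flatAt j m≤j))

        Progress : ℕ → Set
        Progress j = Σ ℕ λ j' → j ≤ j' × m ≤ j' ×
                       nkProg (kind (node j')) (dir j') (traced (node j')) (traced (node (suc j')))

        -- Every non-progressing step lowers the descent.
        progressFrom : ∀ j → m ≤ j → Acc _<_ (descent (node j)) → Progress j
        progressFrom j m≤j (acc rec) with proj₂ (proj₂ (flatAt j m≤j))
        ... | inj₁ prog = j , ≤-refl , m≤j , prog
        ... | inj₂ lower with progressFrom (suc j) (≤-trans m≤j (n≤1+n j)) (rec lower)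
        ...   | j' , sj≤j' , m≤j' , prog = j' , ≤-trans (n≤1+n j) sj≤j' , m≤j' , prog

        progressAfter : ∀ j → Progress j
        progressAfter j with progressFrom (j + m) (m≤n+m m j) (<-wellFounded _)
        ... | j' , j+m≤j' , m≤j' , prog = j' , ≤-trans (m≤m+n j m) j+m≤j' , m≤j' , prog

module Substitution (Sg : Signature) where
  open RTC Sg

  rtc-cong : ∀ {φ φ' s s' t t'} → φ ≡ φ' → s ≡ s' → t ≡ t' → rtc φ s t ≡ rtc φ' s' t'
  rtc-cong refl refl refl = refl

  mutual
    subT-cong : ∀ {σ τ} → σ ≗ τ → subT σ ≗ subT τ
    subT-cong σ≗τ (var x)    = σ≗τ x
    subT-cong σ≗τ (fun f ts) = cong (fun f) (subTs-cong σ≗τ ts)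

    subTs-cong : ∀ {σ τ k} → σ ≗ τ → subTs {k} σ ≗ subTs τ
    subTs-cong σ≗τ []       = refl
    subTs-cong σ≗τ (t ∷ ts) = cong₂ _∷_ (subT-cong σ≗τ t) (subTs-cong σ≗τ ts)

  lift-cong : ∀ {σ τ} → σ ≗ τ → lift σ ≗ lift τ
  lift-cong σ≗τ zero    = refl
  lift-cong σ≗τ (suc x) = cong shiftT (σ≗τ x)

  subF-cong : ∀ {σ τ} → σ ≗ τ → subF σ ≗ subF τ
  subF-cong e (rel P ts)  = cong (rel P) (subTs-cong e ts)
  subF-cong e (s ≐ t)     = cong₂ _≐_ (subT-cong e s) (subT-cong e t)
  subF-cong e (¬' φ)      = cong ¬' (subF-cong e φ)
  subF-cong e (φ ∧' ψ)    = cong₂ _∧'_ (subF-cong e φ) (subF-cong e ψ)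
  subF-cong e (φ ∨' ψ)    = cong₂ _∨'_ (subF-cong e φ) (subF-cong e ψ)
  subF-cong e (φ ⊃' ψ)    = cong₂ _⊃'_ (subF-cong e φ) (subF-cong e ψ)
  subF-cong e (∀' φ)      = cong ∀' (subF-cong (lift-cong e) φ)
  subF-cong e (∃' φ)      = cong ∃' (subF-cong (lift-cong e) φ)
  subF-cong e (rtc φ s t) = rtc-cong (subF-cong (lift-cong (lift-cong e)) φ) (subT-cong e s) (subT-cong e t)

  infixr 9 _∘ₛ_
  _∘ₛ_ : Subst → Subst → Subst
  (σ ∘ₛ τ) x = subT σ (τ x)

  mutual
    subT-renT : ∀ σ ρ t → subT σ (renT ρ t) ≡ subT (λ x → σ (ρ x)) t
    subT-renT σ ρ (var x)    = refl
    subT-renT σ ρ (fun f ts) = cong (fun f) (subTs-renTs σ ρ ts)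

    subTs-renTs : ∀ {k} σ ρ (ts : Vec Term k) → subTs σ (renTs ρ ts) ≡ subTs (λ x → σ (ρ x)) ts
    subTs-renTs σ ρ []       = refl
    subTs-renTs σ ρ (t ∷ ts) = cong₂ _∷_ (subT-renT σ ρ t) (subTs-renTs σ ρ ts)

  mutual
    renT-subT : ∀ ρ σ t → renT ρ (subT σ t) ≡ subT (λ x → renT ρ (σ x)) t
    renT-subT ρ σ (var x)    = refl
    renT-subT ρ σ (fun f ts) = cong (fun f) (renTs-subTs ρ σ ts)

    renTs-subTs : ∀ {k} ρ σ (ts : Vec Term k) → renTs ρ (subTs σ ts) ≡ subTs (λ x → renT ρ (σ x)) ts
    renTs-subTs ρ σ []       = refl
    renTs-subTs ρ σ (t ∷ ts) = cong₂ _∷_ (renT-subT ρ σ t) (renTs-subTs ρ σ ts)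

  mutual
    subT-∘ₛ : ∀ σ τ t → subT σ (subT τ t) ≡ subT (σ ∘ₛ τ) t
    subT-∘ₛ σ τ (var x)    = refl
    subT-∘ₛ σ τ (fun f ts) = cong (fun f) (subTs-∘ₛ σ τ ts)

    subTs-∘ₛ : ∀ {k} σ τ (ts : Vec Term k) → subTs σ (subTs τ ts) ≡ subTs (σ ∘ₛ τ) ts
    subTs-∘ₛ σ τ []       = refl
    subTs-∘ₛ σ τ (t ∷ ts) = cong₂ _∷_ (subT-∘ₛ σ τ t) (subTs-∘ₛ σ τ ts)

  lift-∘ₛ : ∀ σ τ → lift σ ∘ₛ lift τ ≗ lift (σ ∘ₛ τ)
  lift-∘ₛ σ τ zero    = refl
  lift-∘ₛ σ τ (suc x) = trans (subT-renT (lift σ) suc (τ x)) (sym (renT-subT suc σ (τ x)))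

  subF-∘ₛ : ∀ σ τ φ → subF σ (subF τ φ) ≡ subF (σ ∘ₛ τ) φ
  subF-∘ₛ σ τ (rel P ts)  = cong (rel P) (subTs-∘ₛ σ τ ts)
  subF-∘ₛ σ τ (s ≐ t)     = cong₂ _≐_ (subT-∘ₛ σ τ s) (subT-∘ₛ σ τ t)
  subF-∘ₛ σ τ (¬' φ)      = cong ¬' (subF-∘ₛ σ τ φ)
  subF-∘ₛ σ τ (φ ∧' ψ)    = cong₂ _∧'_ (subF-∘ₛ σ τ φ) (subF-∘ₛ σ τ ψ)
  subF-∘ₛ σ τ (φ ∨' ψ)    = cong₂ _∨'_ (subF-∘ₛ σ τ φ) (subF-∘ₛ σ τ ψ)
  subF-∘ₛ σ τ (φ ⊃' ψ)    = cong₂ _⊃'_ (subF-∘ₛ σ τ φ) (subF-∘ₛ σ τ ψ)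
  subF-∘ₛ σ τ (∀' φ)      = cong ∀' (trans (subF-∘ₛ (lift σ) (lift τ) φ) (subF-cong (lift-∘ₛ σ τ) φ))
  subF-∘ₛ σ τ (∃' φ)      = cong ∃' (trans (subF-∘ₛ (lift σ) (lift τ) φ) (subF-cong (lift-∘ₛ σ τ) φ))
  subF-∘ₛ σ τ (rtc φ s t) = rtc-cong
    (trans (subF-∘ₛ (lift (lift σ)) (lift (lift τ)) φ)
           (subF-cong (λ x → trans (lift-∘ₛ (lift σ) (lift τ) x) (lift-cong (lift-∘ₛ σ τ) x)) φ))
    (subT-∘ₛ σ τ s) (subT-∘ₛ σ τ t)

  mutual
    subT-id : ∀ {σ} → σ ≗ var → ∀ t → subT σ t ≡ t
    subT-id σ≗var (var x)    = σ≗var x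
    subT-id σ≗var (fun f ts) = cong (fun f) (subTs-id σ≗var ts)

    subTs-id : ∀ {σ k} → σ ≗ var → (ts : Vec Term k) → subTs σ ts ≡ ts
    subTs-id σ≗var []       = refl
    subTs-id σ≗var (t ∷ ts) = cong₂ _∷_ (subT-id σ≗var t) (subTs-id σ≗var ts)

  lift-id : ∀ {σ} → σ ≗ var → lift σ ≗ var
  lift-id σ≗var zero    = refl
  lift-id σ≗var (suc x) = cong shiftT (σ≗var x)

  subF-id : ∀ {σ} → σ ≗ var → ∀ φ → subF σ φ ≡ φ
  subF-id e (rel P ts)  = cong (rel P) (subTs-id e ts)
  subF-id e (s ≐ t)     = cong₂ _≐_ (subT-id e s) (subT-id e t)
  subF-id e (¬' φ)      = cong ¬' (subF-id e φ)
  subF-id e (φ ∧' ψ)    = cong₂ _∧'_ (subF-id e φ) (subF-id e ψ)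
  subF-id e (φ ∨' ψ)    = cong₂ _∨'_ (subF-id e φ) (subF-id e ψ)
  subF-id e (φ ⊃' ψ)    = cong₂ _⊃'_ (subF-id e φ) (subF-id e ψ)
  subF-id e (∀' φ)      = cong ∀' (subF-id (lift-id e) φ)
  subF-id e (∃' φ)      = cong ∃' (subF-id (lift-id e) φ)
  subF-id e (rtc φ s t) = rtc-cong (subF-id (lift-id (lift-id e)) φ) (subT-id e s) (subT-id e t)

  subF-subF : ∀ {σ τ ρ} φ → σ ∘ₛ τ ≗ ρ → subF σ (subF τ φ) ≡ subF ρ φ
  subF-subF {σ} {τ} φ e = trans (subF-∘ₛ σ τ φ) (subF-cong e φ)

  subF-subF-id : ∀ {σ τ} φ → σ ∘ₛ τ ≗ var → subF σ (subF τ φ) ≡ φ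
  subF-subF-id {σ} {τ} φ e = trans (subF-∘ₛ σ τ φ) (subF-id e φ)

  subF-subF-swap : ∀ {σ τ σ' τ'} φ → σ ∘ₛ τ ≗ σ' ∘ₛ τ' → subF σ (subF τ φ) ≡ subF σ' (subF τ' φ)
  subF-subF-swap {σ' = σ'} {τ'} φ e = trans (subF-subF φ e) (sym (subF-∘ₛ σ' τ' φ))

  shiftT-as-subT : ∀ t → shiftT t ≡ subT (λ x → var (suc x)) t
  shiftT-as-subT t = trans (cong shiftT (sym (subT-id (λ _ → refl) t))) (renT-subT suc var t)

module InductionGadget (Sg : Signature) where
  open RTC Sg
  open Substitution Sg

  wk wk₂ : Subst
  wk  x = var (suc x)
  wk₂ x = var (suc (suc x))

  record IndInstance : Set where
    constructor mkInd
    field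
      Γ Δ : List Formula
      ψ φ : Formula
      s t : Term

  module Gadget (I : IndInstance) where
    open IndInstance I

    conclusion premise : Sequent
    conclusion = ψ ⟨ s ⟩ ∷ rtc φ s t ∷ Γ ⇒ ψ ⟨ t ⟩ ∷ Δ
    premise    = φ ∷ ψ-at-x ψ ∷ map shift2F Γ ⇒ ψ-at-y ψ ∷ map shift2F Δ

    -- The gadget works in the context extended by a fresh z = var 0; the
    -- companion is  (RTC φ)(s,z), ψ(s), Γ ⇒ ψ(z), Δ,  whose Case unfolding
    -- introduces a further fresh z' = var 0 (and z becomes var 1).
    φ↑ : Formula
    φ↑ = subF (lift (lift wk)) φ

    s↑ : Term
    s↑ = shiftT s

    ψ↑ : Formula
    ψ↑ = subF (var 0 ∙ wk₂) ψ

    ψs ψz Rsz : Formula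
    ψs  = shiftF (ψ ⟨ s ⟩)
    ψz  = subF (var 0 ∙ wk) ψ
    Rsz = rtc φ↑ s↑ (var 0)

    Γ↑ Δ↑ : List Formula
    Γ↑ = map shiftF Γ
    Δ↑ = map shiftF Δ

    companion : Sequent
    companion = Rsz ∷ ψs ∷ Γ↑ ⇒ ψz ∷ Δ↑

    stepAnte stepSucc : List Formula
    stepAnte = caseAnc φ↑ s↑ ∷ caseStep φ↑ (var 0) ∷ map shiftF (ψs ∷ Γ↑)
    stepSucc = map shiftF (ψz ∷ Δ↑)

    z↦t z↦z' xy↦z'z : Subst
    z↦t    = t ∙ var
    z↦z'   = var 0 ∙ wk₂
    xy↦z'z = var 1 ∙ (var 0 ∙ wk₂)

    z↦t-shiftF : ∀ A → subF z↦t (shiftF A) ≡ A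
    z↦t-shiftF A = subF-subF-id A (λ _ → refl)

    z↦t-shiftFs : ∀ As → map (subF z↦t) (map shiftF As) ≡ As
    z↦t-shiftFs []       = refl
    z↦t-shiftFs (A ∷ As) = cong₂ _∷_ (z↦t-shiftF A) (z↦t-shiftFs As)

    z↦t-Rsz : subF z↦t Rsz ≡ rtc φ s t
    z↦t-Rsz = rtc-cong (subF-subF-id φ λ { zero → refl ; (suc zero) → refl ; (suc (suc _)) → refl })
                       (trans (subT-renT z↦t suc s) (subT-id (λ _ → refl) s)) refl

    z↦t-ψz : subF z↦t ψz ≡ ψ ⟨ t ⟩
    z↦t-ψz = subF-subF ψ λ { zero → refl ; (suc _) → refl }

    ψ↑-at-z : ψ↑ ⟨ var 0 ⟩ ≡ ψz
    ψ↑-at-z = subF-subF ψ λ { zero → refl ; (suc _) → refl }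

    ψ↑-at-s : ψs ≡ ψ↑ ⟨ s↑ ⟩
    ψ↑-at-s = subF-subF-swap ψ λ { zero → sym (shiftT-as-subT s) ; (suc _) → refl }

    z↦z'-Rsz : subF z↦z' Rsz ≡ caseAnc φ↑ s↑
    z↦z'-Rsz = rtc-cong (subF-subF-swap φ λ { zero → refl ; (suc zero) → refl ; (suc (suc _)) → refl })
      (trans (subT-renT z↦z' suc s) (sym (trans (shiftT-as-subT s↑) (subT-renT wk suc s)))) refl

    z↦z'-shiftFs : ∀ As → map (subF z↦z') (map shiftF As) ≡ map shiftF (map shiftF As)
    z↦z'-shiftFs []       = refl
    z↦z'-shiftFs (A ∷ As) = cong₂ _∷_ (subF-subF-swap A λ _ → refl) (z↦z'-shiftFs As)

    z↦z'-ψz : subF z↦z' ψz ≡ ψ↑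
    z↦z'-ψz = subF-subF ψ λ { zero → refl ; (suc _) → refl }

    xy↦z'z-φ : subF xy↦z'z φ ≡ caseStep φ↑ (var 0)
    xy↦z'z-φ = sym (subF-subF φ λ { zero → refl ; (suc zero) → refl ; (suc (suc _)) → refl })

    xy↦z'z-ψx : subF xy↦z'z (ψ-at-x ψ) ≡ ψ↑
    xy↦z'z-ψx = subF-subF ψ λ { zero → refl ; (suc _) → refl }

    xy↦z'z-ψy : subF xy↦z'z (ψ-at-y ψ) ≡ shiftF ψz
    xy↦z'z-ψy = subF-subF-swap ψ λ { zero → refl ; (suc _) → refl }

    xy↦z'z-shift2Fs : ∀ As → map (subF xy↦z'z) (map shift2F As) ≡ map shiftF (map shiftF As)
    xy↦z'z-shift2Fs []       = refl
    xy↦z'z-shift2Fs (A ∷ As) = cong₂ _∷_ (subF-subF-swap A λ _ → refl) (xy↦z'z-shift2Fs As)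

module GadgetTrees (Sg : Signature) where
  open RTC Sg
  open InductionGadget Sg
  open Gadget

  data Tree : Sequent → Set where
    node   : ∀ {S k} {Ps : Vec Sequent k} → Rule cyc S Ps → ((i : Fin k) → Tree (lookup Ps i)) → Tree S
    gadget : (I : IndInstance) → Tree (premise I) → Tree (conclusion I)

  translate : ∀ {S} → ProvG S → Tree S
  translate (by (axiom φ) ps)    = node (axiom φ) λ i → translate (ps i)
  translate (by (weak Γ⊆ Δ⊆) ps) = node (weak Γ⊆ Δ⊆) λ i → translate (ps i)
  translate (by ¬L ps)           = node ¬L λ i → translate (ps i)
  translate (by ¬R ps)           = node ¬R λ i → translate (ps i)
  translate (by ∧L ps)           = node ∧L λ i → translate (ps i)
  translate (by ∧R ps)           = node ∧R λ i → translate (ps i)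
  translate (by ∨L ps)           = node ∨L λ i → translate (ps i)
  translate (by ∨R ps)           = node ∨R λ i → translate (ps i)
  translate (by ⊃L ps)           = node ⊃L λ i → translate (ps i)
  translate (by ⊃R ps)           = node ⊃R λ i → translate (ps i)
  translate (by (∀L t) ps)       = node (∀L t) λ i → translate (ps i)
  translate (by ∀R ps)           = node ∀R λ i → translate (ps i)
  translate (by ∃L ps)           = node ∃L λ i → translate (ps i)
  translate (by (∃R t) ps)       = node (∃R t) λ i → translate (ps i)
  translate (by (=L₁ {Γ = Γ} {Δ} {φ} {s} {t}) ps) = node (=L₁ {Γ = Γ} {Δ} {φ} {s} {t}) λ i → translate (ps i)
  translate (by (=L₂ {Γ = Γ} {Δ} {φ} {s} {t}) ps) = node (=L₂ {Γ = Γ} {Δ} {φ} {s} {t}) λ i → translate (ps i)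
  translate (by (=R t) ps)       = node (=R t) λ i → translate (ps i)
  translate (by cut ps)          = node cut λ i → translate (ps i)
  translate (by (sub θ) ps)      = node (sub θ) λ i → translate (ps i)
  translate (by rtc-refl ps)     = node rtc-refl λ i → translate (ps i)
  translate (by (rtc-trans {Γ = Γ} {Δ} {φ} {s} {r} {t}) ps) =
    node (rtc-trans {Γ = Γ} {Δ} {φ} {s} {r} {t}) λ i → translate (ps i)
  translate (by (rtc-ind {Γ} {Δ} {ψ} {φ} {s} {t}) ps) = gadget (mkInd Γ Δ ψ φ s t) (translate (ps zero))

  _/ₛ_ : Sequent → Subst → Sequent
  (Γ ⇒ Δ) /ₛ θ = map (subF θ) Γ ⇒ map (subF θ) Δ

  -- Nodes of the Ind gadget, each followed by its premises; loop-bud is a bud of comp-case: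
  --   ind-root → close-t → comp-case → eq-case → eq-weak → eq-axiom
  --                        comp-case → step-cut → loop-weak → loop-subst → loop-bud
  --                                    step-cut → prem-weak → prem-subst → (premise derivation)
  GadgetNode : Set
  GadgetNode = Fin 12

  pattern ind-root   = zero
  pattern close-t    = suc ind-root
  pattern comp-case  = suc close-t
  pattern eq-case    = suc comp-case
  pattern eq-weak    = suc eq-case
  pattern eq-axiom   = suc eq-weak
  pattern step-cut   = suc eq-axiom
  pattern loop-weak  = suc step-cut
  pattern loop-subst = suc loop-weak
  pattern loop-bud   = suc loop-subst
  pattern prem-weak  = suc loop-bud
  pattern prem-subst = suc prem-weak

  gArity : GadgetNode → ℕ
  gArity comp-case = 2
  gArity eq-axiom  = 0
  gArity step-cut  = 2
  gArity loop-bud  = 0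
  gArity _         = 1

  gSequent : IndInstance → GadgetNode → Sequent
  gSequent I ind-root   = conclusion I
  gSequent I close-t    = companion I /ₛ z↦t I
  gSequent I comp-case  = companion I
  gSequent I eq-case    = s↑ I ≐ var 0 ∷ ψs I ∷ Γ↑ I ⇒ ψ↑ I ⟨ var 0 ⟩ ∷ Δ↑ I
  gSequent I eq-weak    = ψs I ∷ Γ↑ I ⇒ ψ↑ I ⟨ s↑ I ⟩ ∷ Δ↑ I
  gSequent I eq-axiom   = [ ψs I ] ⇒ [ ψs I ]
  gSequent I step-cut   = stepAnte I ⇒ stepSucc I
  gSequent I loop-weak  = stepAnte I ⇒ ψ↑ I ∷ stepSucc I
  gSequent I loop-subst = companion I /ₛ z↦z' I
  gSequent I loop-bud   = companion I
  gSequent I prem-weak  = ψ↑ I ∷ stepAnte I ⇒ stepSucc I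
  gSequent I prem-subst = premise I /ₛ xy↦z'z I

  -- Levels rise along every edge except around the loop comp-case → … → loop-bud, where they
  -- stay constant and the descent falls after the progressing Case step.
  gLevel gDescent gDepth : GadgetNode → ℕ
  gLevel ind-root   = 0
  gLevel close-t    = 1
  gLevel eq-case    = 3
  gLevel eq-weak    = 4
  gLevel eq-axiom   = 5
  gLevel prem-weak  = 3
  gLevel prem-subst = 4
  gLevel _          = 2

  gDescent step-cut   = 3
  gDescent loop-weak  = 2
  gDescent loop-subst = 1
  gDescent _          = 0

  gDepth ind-root   = 0
  gDepth close-t    = 1
  gDepth comp-case  = 2
  gDepth eq-case    = 3
  gDepth eq-weak    = 4
  gDepth eq-axiom   = 5
  gDepth step-cut   = 3
  gDepth loop-weak  = 4
  gDepth loop-subst = 5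
  gDepth loop-bud   = 6
  gDepth prem-weak  = 4
  gDepth prem-subst = 5

  gLoopNext : GadgetNode → Maybe GadgetNode
  gLoopNext comp-case  = just step-cut
  gLoopNext step-cut   = just loop-weak
  gLoopNext loop-weak  = just loop-subst
  gLoopNext loop-subst = just loop-bud
  gLoopNext loop-bud   = just comp-case
  gLoopNext _          = nothing

  gTraced : IndInstance → GadgetNode → Formula
  gTraced I step-cut   = caseAnc (φ↑ I) (s↑ I)
  gTraced I loop-weak  = caseAnc (φ↑ I) (s↑ I)
  gTraced I loop-subst = subF (z↦z' I) (Rsz I)
  gTraced I _          = Rsz I

  data Pos : ∀ {S} → Tree S → Set where
    here      : ∀ {S k} {Ps : Vec Sequent k} {r : Rule cyc S Ps} {ts} → Pos (node r ts)
    below     : ∀ {S k} {Ps : Vec Sequent k} {r : Rule cyc S Ps} {ts} (i : Fin k) → Pos (ts i) → Pos (node r ts)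
    local     : ∀ {I T} → GadgetNode → Pos (gadget I T)
    inPremise : ∀ {I T} → Pos T → Pos (gadget I T)

  root : ∀ {S} (t : Tree S) → Pos t
  root (node r ts)  = here
  root (gadget I T) = local ind-root

  arityAt : ∀ {S} {t : Tree S} → Pos t → ℕ
  arityAt (here {k = k}) = k
  arityAt (below i p)    = arityAt p
  arityAt (local x)      = gArity x
  arityAt (inPremise p)  = arityAt p

  localChild : ∀ {I T} (x : GadgetNode) → Fin (gArity x) → Pos (gadget I T)
  localChild ind-root   zero       = local close-t
  localChild close-t    zero       = local comp-case
  localChild comp-case  zero       = local eq-case
  localChild comp-case  (suc zero) = local step-cut
  localChild eq-case    zero       = local eq-weak
  localChild eq-weak    zero       = local eq-axiom
  localChild step-cut   zero       = local loop-weak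
  localChild step-cut   (suc zero) = local prem-weak
  localChild loop-weak  zero       = local loop-subst
  localChild loop-subst zero       = local loop-bud
  localChild prem-weak  zero       = local prem-subst
  localChild {T = T} prem-subst zero = inPremise (root T)

  childAt : ∀ {S} {t : Tree S} (p : Pos t) → Fin (arityAt p) → Pos t
  childAt {t = node r ts} here i = below i (root (ts i))
  childAt (below i p)   j = below i (childAt p j)
  childAt (local x)     j = localChild x j
  childAt (inPremise p) j = inPremise (childAt p j)

  sequentAt : ∀ {S} {t : Tree S} → Pos t → Sequent
  sequentAt {S} here                   = S
  sequentAt (below i p)                = sequentAt p
  sequentAt {t = gadget I T} (local x) = gSequent I x
  sequentAt (inPremise p)              = sequentAt p

  sequentAt-root : ∀ {S} (t : Tree S) → sequentAt (root t) ≡ S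
  sequentAt-root (node r ts)  = refl
  sequentAt-root (gadget I T) = refl

  level descent depth : ∀ {S} {t : Tree S} → Pos t → ℕ
  level here          = 0
  level (below i p)   = suc (level p)
  level (local x)     = gLevel x
  level (inPremise p) = 5 + level p

  descent here          = 0
  descent (below i p)   = descent p
  descent (local x)     = gDescent x
  descent (inPremise p) = descent p

  depth here          = 0
  depth (below i p)   = suc (depth p)
  depth (local x)     = gDepth x
  depth (inPremise p) = 6 + depth p

  -- The formula at `here` is never read: traces are only followed along gadget loops.
  traced : ∀ {S} {t : Tree S} → Pos t → Formula
  traced here                            = var 0 ≐ var 0
  traced (below i p)                     = traced p
  traced {t = gadget I T} (local x)      = gTraced I x
  traced (inPremise p)                   = traced p

  data BudOf : ∀ {S} {t : Tree S} → Pos t → Pos t → Set where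
    loopBud      : ∀ {I T} → BudOf {t = gadget I T} (local loop-bud) (local comp-case)
    budBelow     : ∀ {S k} {Ps : Vec Sequent k} {r : Rule cyc S Ps} {ts} {i} {p c : Pos (ts i)} →
                   BudOf p c → BudOf {t = node r ts} (below i p) (below i c)
    budInPremise : ∀ {I T} {p c : Pos T} → BudOf p c → BudOf {t = gadget I T} (inPremise p) (inPremise c)

  data Kind {S} {t : Tree S} (p : Pos t) : Set where
    bud   : (c : Pos t) → BudOf p c → sequentAt c ≡ sequentAt p → Kind p
    inner : ∀ {Ps : Vec Sequent (arityAt p)} → Rule cyc (sequentAt p) Ps →
            (∀ i → sequentAt (childAt p i) ≡ lookup Ps i) → Kind p

  gKind : ∀ I T (x : GadgetNode) → Kind {t = gadget I T} (local x)
  gKind I T ind-root   = inner (weak (⊆-trans (⊆-reflexive ante≡) (⊆-reflexive-↭ (swap _ _ ↭-refl)))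
                                     (⊆-reflexive (cong₂ _∷_ (z↦t-ψz I) (z↦t-shiftFs I _))))
                               λ { zero → refl }
    where
    open IndInstance I
    ante≡ : map (subF (z↦t I)) (Sequent.ante (companion I)) ≡ rtc φ s t ∷ ψ ⟨ s ⟩ ∷ Γ
    ante≡ = cong₂ _∷_ (z↦t-Rsz I) (z↦t-shiftFs I (_ ∷ _))
  gKind I T close-t    = inner (sub (z↦t I)) λ { zero → refl }
  gKind I T comp-case  = inner rtc-case λ
    { zero       → cong (λ A → s↑ I ≐ var 0 ∷ ψs I ∷ Γ↑ I ⇒ A ∷ Δ↑ I) (ψ↑-at-z I)
    ; (suc zero) → refl }
  gKind I T eq-case    = inner (=L₁ {Γ = ψs I ∷ Γ↑ I} {Δ↑ I} {ψ↑ I} {s↑ I} {var 0}) λ { zero → refl }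
  gKind I T eq-weak    = inner (weak (∷⁺ʳ _ λ ()) (⊆-trans (⊆-reflexive (cong [_] (ψ↑-at-s I))) (∷⁺ʳ _ λ ())))
                               λ { zero → refl }
  gKind I T eq-axiom   = inner (axiom (ψs I)) λ ()
  gKind I T step-cut   = inner (cut {φ = ψ↑ I}) λ { zero → refl ; (suc zero) → refl }
  gKind I T loop-weak  = inner (weak (⊆-trans (⊆-reflexive (cong₂ _∷_ (z↦z'-Rsz I) (z↦z'-shiftFs I (_ ∷ _))))
                                              (∷⁺ʳ _ (xs⊆x∷xs _ _)))
                                     (⊆-trans (⊆-reflexive (cong₂ _∷_ (z↦z'-ψz I) (z↦z'-shiftFs I _)))
                                              (∷⁺ʳ _ (xs⊆x∷xs _ _))))
                               λ { zero → refl }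
  gKind I T loop-subst = inner (sub (z↦z' I)) λ { zero → refl }
  gKind I T loop-bud   = bud (local comp-case) loopBud refl
  gKind I T prem-weak  = inner (weak (⊆-trans (⊆-reflexive (cong₂ _∷_ (xy↦z'z-φ I)
                                                 (cong₂ _∷_ (xy↦z'z-ψx I) (xy↦z'z-shift2Fs I _))))
                                              (∈-∷⁺ʳ (there (there (here refl)))
                                                (∈-∷⁺ʳ (here refl) λ A∈ → there (there (there (there A∈))))))
                                     (⊆-reflexive (cong₂ _∷_ (xy↦z'z-ψy I) (xy↦z'z-shift2Fs I _))))
                               λ { zero → refl }
  gKind I T prem-subst = inner (sub (xy↦z'z I)) λ { zero → sequentAt-root T }

  kindBelow : ∀ {S k} {Ps : Vec Sequent k} {r : Rule cyc S Ps} {ts} {i} {p : Pos (ts i)} →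
              Kind p → Kind {t = node r ts} (below i p)
  kindBelow (bud c b e)   = bud (below _ c) (budBelow b) e
  kindBelow (inner r e)   = inner r e

  kindInPremise : ∀ {I T} {p : Pos T} → Kind p → Kind {t = gadget I T} (inPremise p)
  kindInPremise (bud c b e) = bud (inPremise c) (budInPremise b) e
  kindInPremise (inner r e) = inner r e

  kindAt : ∀ {S} {t : Tree S} (p : Pos t) → Kind p
  kindAt {t = node r ts} here         = inner r λ i → sequentAt-root (ts i)
  kindAt (below i p)                  = kindBelow (kindAt p)
  kindAt {t = gadget I T} (local x)   = gKind I T x
  kindAt (inPremise p)                = kindInPremise (kindAt p)

  IsInner : ∀ {S} {t : Tree S} {p : Pos t} → Kind p → Set
  IsInner (bud _ _ _) = ⊥
  IsInner (inner _ _) = ⊤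

  resolveKind : ∀ {S} {t : Tree S} {p : Pos t} → Kind p → Pos t
  resolveKind (bud c _ _)         = c
  resolveKind {p = p} (inner _ _) = p

  resolveAt : ∀ {S} {t : Tree S} → Pos t → Pos t
  resolveAt p = resolveKind (kindAt p)

  kTrace kProg : ∀ {S} {t : Tree S} {p : Pos t} → Kind p → Fin (arityAt p) → Formula → Formula → Set
  kTrace (bud _ _ _) _ _ _ = ⊥
  kTrace (inner r _) i     = TracePair r i
  kProg  (bud _ _ _) _ _ _ = ⊥
  kProg  (inner r _) i     = ProgPair r i

  loopNext : ∀ {S} {t : Tree S} → Pos t → Maybe (Pos t)
  loopNext here          = nothing
  loopNext (below i p)   = Maybe.map (below i) (loopNext p)
  loopNext (local x)     = Maybe.map local (gLoopNext x)
  loopNext (inPremise p) = Maybe.map inPremise (loopNext p)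

  budOf-arity : ∀ {S} {t : Tree S} {p c : Pos t} → BudOf p c → arityAt p ≡ 0
  budOf-arity loopBud          = refl
  budOf-arity (budBelow b)     = budOf-arity b
  budOf-arity (budInPremise b) = budOf-arity b

  budOf-level : ∀ {S} {t : Tree S} {p c : Pos t} → BudOf p c → level p ≡ level c
  budOf-level loopBud          = refl
  budOf-level (budBelow b)     = cong suc (budOf-level b)
  budOf-level (budInPremise b) = cong (5 +_) (budOf-level b)

  budOf-loopNext : ∀ {S} {t : Tree S} {p c : Pos t} → BudOf p c → loopNext p ≡ just c
  budOf-loopNext loopBud          = refl
  budOf-loopNext (budBelow b)     = cong (Maybe.map (below _)) (budOf-loopNext b)
  budOf-loopNext (budInPremise b) = cong (Maybe.map inPremise) (budOf-loopNext b)

  budOf-companion-inner : ∀ {S} {t : Tree S} {p c : Pos t} → BudOf p c → IsInner (kindAt c)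
  budOf-companion-inner loopBud = tt
  budOf-companion-inner (budBelow {c = c} b) with kindAt c | budOf-companion-inner b
  ... | inner _ _ | tt = tt
  budOf-companion-inner (budInPremise {c = c} b) with kindAt c | budOf-companion-inner b
  ... | inner _ _ | tt = tt

  ≤-lit : ∀ {m n} {m≤n : True (m ≤? n)} → m ≤ n
  ≤-lit {m≤n = m≤n} = toWitness m≤n

  level-child : ∀ {S} {t : Tree S} (p : Pos t) i → level p ≤ level (childAt p i)
  level-child here                     i          = z≤n
  level-child (below i p)              j          = s≤s (level-child p j)
  level-child (inPremise p)            j          = +-monoʳ-≤ 5 (level-child p j)
  level-child (local ind-root)         zero       = ≤-lit
  level-child (local close-t)          zero       = ≤-lit
  level-child (local comp-case)        zero       = ≤-lit
  level-child (local comp-case)        (suc zero) = ≤-lit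
  level-child (local eq-case)          zero       = ≤-lit
  level-child (local eq-weak)          zero       = ≤-lit
  level-child (local step-cut)         zero       = ≤-lit
  level-child (local step-cut)         (suc zero) = ≤-lit
  level-child (local loop-weak)        zero       = ≤-lit
  level-child (local loop-subst)       zero       = ≤-lit
  level-child (local prem-weak)        zero       = ≤-lit
  level-child (local prem-subst)       zero       = ≤-trans ≤-lit (m≤m+n 5 _)

  loopNext-child : ∀ {S} {t : Tree S} (p : Pos t) i → level p ≡ level (childAt p i) →
                   loopNext p ≡ just (childAt p i)
  loopNext-child (below i p)        j          e = cong (Maybe.map (below i)) (loopNext-child p j (suc-injective e))
  loopNext-child (inPremise p)      j          e = cong (Maybe.map inPremise) (loopNext-child p j (+-cancelˡ-≡ 5 _ _ e))
  loopNext-child (local comp-case)  (suc zero) e = refl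
  loopNext-child (local step-cut)   zero       e = refl
  loopNext-child (local loop-weak)  zero       e = refl
  loopNext-child (local loop-subst) zero       e = refl
  loopNext-child here                     _    ()
  loopNext-child (local ind-root)   zero       ()
  loopNext-child (local close-t)    zero       ()
  loopNext-child (local comp-case)  zero       ()
  loopNext-child (local eq-case)    zero       ()
  loopNext-child (local eq-weak)    zero       ()
  loopNext-child (local step-cut)   (suc zero) ()
  loopNext-child (local prem-weak)  zero       ()
  loopNext-child (local prem-subst) zero       ()

  depth-child : ∀ {S} {t : Tree S} (p : Pos t) i → depth p < depth (childAt p i)
  depth-child here                     i          = s≤s z≤n
  depth-child (below i p)              j          = s≤s (depth-child p j)
  depth-child (inPremise p)            j          = +-monoʳ-< 6 (depth-child p j)
  depth-child (local ind-root)         zero       = ≤-lit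
  depth-child (local close-t)          zero       = ≤-lit
  depth-child (local comp-case)        zero       = ≤-lit
  depth-child (local comp-case)        (suc zero) = ≤-lit
  depth-child (local eq-case)          zero       = ≤-lit
  depth-child (local eq-weak)          zero       = ≤-lit
  depth-child (local step-cut)         zero       = ≤-lit
  depth-child (local step-cut)         (suc zero) = ≤-lit
  depth-child (local loop-weak)        zero       = ≤-lit
  depth-child (local loop-subst)       zero       = ≤-lit
  depth-child (local prem-weak)        zero       = ≤-lit
  depth-child (local prem-subst)       zero       = m≤m+n 6 _

  depth-root : ∀ {S} (t : Tree S) → depth (root t) ≡ 0
  depth-root (node r ts)  = refl
  depth-root (gadget I T) = refl

  childAt-not-root : ∀ {S} {t : Tree S} (p : Pos t) i → childAt p i ≢ root t
  childAt-not-root {t = t} p i e = n≮0 (subst (depth p <_) (trans (cong depth e) (depth-root t)) (depth-child p i))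

  Slot : ∀ {S} → Tree S → Set
  Slot t = Σ (Pos t) λ p → Fin (arityAt p)

  Parent : ∀ {S} {t : Tree S} → Pos t → Set
  Parent {t = t} x = Σ (Slot t) λ (p , i) → childAt p i ≡ x

  RootOrChild : ∀ {S} {t : Tree S} → Pos t → Set
  RootOrChild {t = t} x = x ≡ root t ⊎ Parent x

  rootOrChild-below : ∀ {S k} {Ps : Vec Sequent k} {r : Rule cyc S Ps} {ts} {i} {x : Pos (ts i)} →
                      RootOrChild x → RootOrChild {t = node r ts} (below i x)
  rootOrChild-below {i = i} (inj₁ refl)          = inj₂ ((here , i) , refl)
  rootOrChild-below {i = i} (inj₂ ((p , j) , e)) = inj₂ ((below i p , j) , cong (below i) e)

  rootOrChild-inPremise : ∀ {I T} {x : Pos T} → RootOrChild x → RootOrChild {t = gadget I T} (inPremise x)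
  rootOrChild-inPremise (inj₁ refl)          = inj₂ ((local prem-subst , zero) , refl)
  rootOrChild-inPremise (inj₂ ((p , j) , e)) = inj₂ ((inPremise p , j) , cong inPremise e)

  rootOrChild : ∀ {S} {t : Tree S} (x : Pos t) → RootOrChild x
  rootOrChild here               = inj₁ refl
  rootOrChild (below i x)        = rootOrChild-below (rootOrChild x)
  rootOrChild (inPremise x)      = rootOrChild-inPremise (rootOrChild x)
  rootOrChild (local ind-root)   = inj₁ refl
  rootOrChild (local close-t)    = inj₂ ((local ind-root , zero) , refl)
  rootOrChild (local comp-case)  = inj₂ ((local close-t , zero) , refl)
  rootOrChild (local eq-case)    = inj₂ ((local comp-case , zero) , refl)
  rootOrChild (local eq-weak)    = inj₂ ((local eq-case , zero) , refl)
  rootOrChild (local eq-axiom)   = inj₂ ((local eq-weak , zero) , refl)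
  rootOrChild (local step-cut)   = inj₂ ((local comp-case , suc zero) , refl)
  rootOrChild (local loop-weak)  = inj₂ ((local step-cut , zero) , refl)
  rootOrChild (local loop-subst) = inj₂ ((local loop-weak , zero) , refl)
  rootOrChild (local loop-bud)   = inj₂ ((local loop-subst , zero) , refl)
  rootOrChild (local prem-weak)  = inj₂ ((local step-cut , suc zero) , refl)
  rootOrChild (local prem-subst) = inj₂ ((local prem-weak , zero) , refl)

  rootOrChild-root : ∀ {S} (t : Tree S) → rootOrChild (root t) ≡ inj₁ refl
  rootOrChild-root (node r ts)  = refl
  rootOrChild-root (gadget I T) = refl

  slotOf : ∀ {S} {t : Tree S} {x : Pos t} → RootOrChild x → Maybe (Slot t)
  slotOf = [ (λ _ → nothing) , (λ (slot , _) → just slot) ]′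

  parent : ∀ {S} {t : Tree S} → Pos t → Maybe (Slot t)
  parent x = slotOf (rootOrChild x)

  parent-childAt : ∀ {S} {t : Tree S} (p : Pos t) i → parent (childAt p i) ≡ just (p , i)
  parent-childAt {t = node r ts} here i rewrite rootOrChild-root (ts i) = refl
  parent-childAt (below i p) j   = slot-below (rootOrChild (childAt p j)) (parent-childAt p j)
    where
    slot-below : ∀ {x} (r : RootOrChild x) → slotOf r ≡ just (p , j) →
                 slotOf (rootOrChild-below {i = i} r) ≡ just (below i p , j)
    slot-below (inj₂ _) refl = refl
  parent-childAt (inPremise p) j = slot-inPremise (rootOrChild (childAt p j)) (parent-childAt p j)
    where
    slot-inPremise : ∀ {x} (r : RootOrChild x) → slotOf r ≡ just (p , j) →
                     slotOf (rootOrChild-inPremise r) ≡ just (inPremise p , j)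
    slot-inPremise (inj₂ _) refl = refl
  parent-childAt {t = gadget I T} (local prem-subst) zero rewrite rootOrChild-root T = refl
  parent-childAt (local ind-root)   zero       = refl
  parent-childAt (local close-t)    zero       = refl
  parent-childAt (local comp-case)  zero       = refl
  parent-childAt (local comp-case)  (suc zero) = refl
  parent-childAt (local eq-case)    zero       = refl
  parent-childAt (local eq-weak)    zero       = refl
  parent-childAt (local step-cut)   zero       = refl
  parent-childAt (local step-cut)   (suc zero) = refl
  parent-childAt (local loop-weak)  zero       = refl
  parent-childAt (local loop-subst) zero       = refl
  parent-childAt (local prem-weak)  zero       = refl

  resolveAt-below : ∀ {S k} {Ps : Vec Sequent k} {r : Rule cyc S Ps} {ts} {i} (x : Pos (ts i)) →
                    resolveAt {t = node r ts} (below i x) ≡ below i (resolveAt x)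
  resolveAt-below x with kindAt x
  ... | bud _ _ _ = refl
  ... | inner _ _ = refl

  resolveAt-inPremise : ∀ {I T} (x : Pos T) → resolveAt {t = gadget I T} (inPremise x) ≡ inPremise (resolveAt x)
  resolveAt-inPremise x with kindAt x
  ... | bud _ _ _ = refl
  ... | inner _ _ = refl

  StepTo : ∀ {S} {t : Tree S} (p : Pos t) → Fin (arityAt p) → Pos t → Set
  StepTo p i w = level p < level w
               ⊎ (level p ≡ level w × kTrace (kindAt p) i (traced p) (traced w)
                  × (kProg (kindAt p) i (traced p) (traced w) ⊎ descent w < descent p))

  stepTo-below : ∀ {S k} {Ps : Vec Sequent k} {r : Rule cyc S Ps} {ts} {i} {p w : Pos (ts i)} {j} →
                 StepTo p j w → StepTo {t = node r ts} (below i p) j (below i w)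
  stepTo-below {p = p} step with kindAt p | step
  ... | _         | inj₁ rise                  = inj₁ (s≤s rise)
  ... | inner _ _ | inj₂ (same , trace , next) = inj₂ (cong suc same , trace , next)

  stepTo-inPremise : ∀ {I T} {p w : Pos T} {j} → StepTo p j w → StepTo {t = gadget I T} (inPremise p) j (inPremise w)
  stepTo-inPremise {p = p} step with kindAt p | step
  ... | _         | inj₁ rise                  = inj₁ (+-monoʳ-< 5 rise)
  ... | inner _ _ | inj₂ (same , trace , next) = inj₂ (cong (5 +_) same , trace , next)

  traceStep : ∀ {S} {t : Tree S} (p : Pos t) i → StepTo p i (resolveAt (childAt p i))
  traceStep {t = node r ts} here i =
    subst (StepTo {t = node r ts} here i) (sym (resolveAt-below {r = r} (root (ts i)))) (inj₁ (s≤s z≤n))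
  traceStep {t = node r ts} (below i p) j =
    subst (StepTo {t = node r ts} (below i p) j) (sym (resolveAt-below {r = r} (childAt p j)))
          (stepTo-below {r = r} {ts} {i} {p} {resolveAt (childAt p j)} (traceStep p j))
  traceStep {t = gadget I T} (inPremise p) j =
    subst (StepTo {t = gadget I T} (inPremise p) j) (sym (resolveAt-inPremise {I} (childAt p j)))
          (stepTo-inPremise {I} {p = p} {resolveAt (childAt p j)} (traceStep p j))
  traceStep {t = gadget I T} (local prem-subst) zero =
    subst (StepTo {t = gadget I T} (local prem-subst) zero) (sym (resolveAt-inPremise {I} (root T)))
          (inj₁ (≤-trans ≤-lit (m≤m+n 5 _)))
  traceStep (local ind-root)   zero       = inj₁ ≤-lit
  traceStep (local close-t)    zero       = inj₁ ≤-lit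
  traceStep (local comp-case)  zero       = inj₁ ≤-lit
  traceStep (local comp-case)  (suc zero) =
    inj₂ (refl , inj₂ (tt , tt , here refl , here refl , refl , refl)
               , inj₁ (tt , tt , here refl , here refl , refl , refl))
  traceStep (local eq-case)    zero       = inj₁ ≤-lit
  traceStep (local eq-weak)    zero       = inj₁ ≤-lit
  traceStep (local step-cut)   zero       = inj₂ (refl , inj₁ (tt , tt , here refl , here refl , refl) , inj₂ ≤-lit)
  traceStep (local step-cut)   (suc zero) = inj₁ ≤-lit
  traceStep {t = gadget I T} (local loop-weak) zero =
    inj₂ (refl , inj₁ (tt , tt , here refl , here refl , z↦z'-Rsz I) , inj₂ ≤-lit)
  traceStep (local loop-subst) zero       = inj₂ (refl , inj₁ (tt , tt , here refl , here refl , refl) , inj₂ ≤-lit)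
  traceStep (local prem-weak)  zero       = inj₁ ≤-lit

module FinSum where

  ∑ : (k : ℕ) → (Fin k → ℕ) → ℕ
  ∑ zero    f = 0
  ∑ (suc k) f = f zero + ∑ k (f ∘ suc)

  inject∑ : ∀ {k} (f : Fin k → ℕ) (i : Fin k) → Fin (f i) → Fin (∑ k f)
  inject∑ f zero    x = x ↑ˡ _
  inject∑ f (suc i) x = f zero ↑ʳ inject∑ (f ∘ suc) i x

  split∑ : ∀ {k} (f : Fin k → ℕ) → Fin (∑ k f) → Σ (Fin k) (Fin ∘ f)
  split∑ {suc k} f v with splitAt (f zero) v
  ... | inj₁ x = zero , x
  ... | inj₂ w with split∑ (f ∘ suc) w
  ...   | i , x = suc i , x

  split∑-inject∑ : ∀ {k} (f : Fin k → ℕ) i x → split∑ f (inject∑ f i x) ≡ (i , x)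
  split∑-inject∑ f zero    x rewrite splitAt-↑ˡ (f zero) x (∑ _ (f ∘ suc)) = refl
  split∑-inject∑ f (suc i) x
    rewrite splitAt-↑ʳ (f zero) (∑ _ (f ∘ suc)) (inject∑ (f ∘ suc) i x)
          | split∑-inject∑ (f ∘ suc) i x = refl

  inject∑-split∑ : ∀ {k} (f : Fin k → ℕ) v → inject∑ f (proj₁ (split∑ f v)) (proj₂ (split∑ f v)) ≡ v
  inject∑-split∑ {suc k} f v with splitAt (f zero) v in eq
  ... | inj₁ x = splitAt⁻¹-↑ˡ eq
  ... | inj₂ w with split∑ (f ∘ suc) w | inject∑-split∑ (f ∘ suc) w
  ...   | i , x | e = trans (cong (f zero ↑ʳ_) e) (splitAt⁻¹-↑ʳ eq)

  ≤-∑ : ∀ {k} (f : Fin k → ℕ) i → f i ≤ ∑ k f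
  ≤-∑ f zero    = m≤m+n (f zero) _
  ≤-∑ f (suc i) = ≤-trans (≤-∑ (f ∘ suc) i) (m≤n+m _ (f zero))

module Flattening (Sg : Signature) where
  open RTC Sg
  open GadgetTrees Sg
  open FinSum

  size : ∀ {S} → Tree S → ℕ
  size (node r ts)  = suc (∑ _ (λ i → size (ts i)))
  size (gadget I T) = 12 + size T

  toFin : ∀ {S} {t : Tree S} → Pos t → Fin (size t)
  toFin here                         = zero
  toFin {t = node r ts} (below i p)  = suc (inject∑ (λ i → size (ts i)) i (toFin p))
  toFin {t = gadget I T} (local x)   = x ↑ˡ size T
  toFin (inPremise p)                = 12 ↑ʳ toFin p

  fromFin : ∀ {S} (t : Tree S) → Fin (size t) → Pos t
  fromFin (node r ts) zero    = here
  fromFin (node r ts) (suc v) with split∑ (λ i → size (ts i)) v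
  ... | i , w = below i (fromFin (ts i) w)
  fromFin (gadget I T) v with splitAt 12 v
  ... | inj₁ x = local x
  ... | inj₂ w = inPremise (fromFin T w)

  fromFin-toFin : ∀ {S} {t : Tree S} (p : Pos t) → fromFin t (toFin p) ≡ p
  fromFin-toFin here = refl
  fromFin-toFin {t = node r ts} (below i p)
    rewrite split∑-inject∑ (λ i → size (ts i)) i (toFin p) = cong (below i) (fromFin-toFin p)
  fromFin-toFin {t = gadget I T} (local x) rewrite splitAt-↑ˡ 12 x (size T) = refl
  fromFin-toFin {t = gadget I T} (inPremise p)
    rewrite splitAt-↑ʳ 12 (size T) (toFin p) = cong inPremise (fromFin-toFin p)

  toFin-fromFin : ∀ {S} (t : Tree S) v → toFin (fromFin t v) ≡ v
  toFin-fromFin (node r ts) zero = refl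
  toFin-fromFin (node r ts) (suc v)
    with split∑ (λ i → size (ts i)) v | inject∑-split∑ (λ i → size (ts i)) v
  ... | i , w | e rewrite toFin-fromFin (ts i) w = cong suc e
  toFin-fromFin (gadget I T) v with splitAt 12 v in eq
  ... | inj₁ x = splitAt⁻¹-↑ˡ eq
  ... | inj₂ w rewrite toFin-fromFin T w = splitAt⁻¹-↑ʳ eq

  gLevel-≤5 : ∀ x → gLevel x ≤ 5
  gLevel-≤5 = toWitness {a? = all? λ x → gLevel x ≤? 5} _

  level-≤-size : ∀ {S} {t : Tree S} (p : Pos t) → level p ≤ size t
  level-≤-size here                        = z≤n
  level-≤-size {t = node r ts} (below i p) = s≤s (≤-trans (level-≤-size p) (≤-∑ (λ i → size (ts i)) i))
  level-≤-size (local x)                   = ≤-trans (gLevel-≤5 x) (m≤m+n 5 _)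
  level-≤-size (inPremise p)               = +-mono-≤ (≤-lit {5} {12}) (level-≤-size p)

module Assembly (Sg : Signature) where
  open RTC Sg
  open GadgetTrees Sg
  open Flattening Sg

  module _ {S : Sequent} (t : Tree S) where

    at : Fin (size t) → Pos t
    at = fromFin t

    toFin-injective : ∀ {p q : Pos t} → toFin p ≡ toFin q → p ≡ q
    toFin-injective {p} {q} e = trans (sym (fromFin-toFin p)) (trans (cong at e) (fromFin-toFin q))

    nodeKind : ∀ v → Kind (at v) → NodeKind (size t) (sequentAt ∘ at) v
    nodeKind v (bud c _ e) = bud (toFin c) (trans (cong sequentAt (fromFin-toFin c)) e)
    nodeKind v (inner r e) = inner r (tabulate (toFin ∘ childAt (at v))) λ i →
      trans (cong (sequentAt ∘ at) (lookup∘tabulate (toFin ∘ childAt (at v)) i))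
            (trans (cong sequentAt (fromFin-toFin (childAt (at v) i))) (e i))

    preproof : Preproof
    preproof = record
      { size = size t
      ; seq  = sequentAt ∘ at
      ; kind = λ v → nodeKind v (kindAt (at v))
      ; root = toFin (root t) }

    nkChild-childAt : ∀ v (k : Kind (at v)) (i : Fin (nkArity (nodeKind v k))) →
      Σ (Fin (arityAt (at v))) λ j → nkChild (nodeKind v k) i ≡ toFin (childAt (at v) j)
        × (∀ {τ τ'} → kTrace k j τ τ' → nkTrace (nodeKind v k) i τ τ')
        × (∀ {τ τ'} → kProg k j τ τ' → nkProg (nodeKind v k) i τ τ')
    nkChild-childAt v (inner _ _) i = i , lookup∘tabulate (toFin ∘ childAt (at v)) i , id , id

    childAt-nkChild : ∀ v (k : Kind (at v)) (j : Fin (arityAt (at v))) →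
      Σ (Fin (nkArity (nodeKind v k))) λ i → nkChild (nodeKind v k) i ≡ toFin (childAt (at v) j)
    childAt-nkChild v (inner _ _) j = j , lookup∘tabulate (toFin ∘ childAt (at v)) j
    childAt-nkChild v (bud _ b _) j = ⊥-elim (¬Fin0 (subst Fin (budOf-arity b) j))

    nkResolve-resolveKind : ∀ v (k : Kind (at v)) → nkResolve (nodeKind v k) ≡ toFin (resolveKind k)
    nkResolve-resolveKind v (bud _ _ _) = refl
    nkResolve-resolveKind v (inner _ _) = sym (toFin-fromFin t v)

    inner-nkBud : ∀ v (k : Kind (at v)) → IsInner k → nkBud (nodeKind v k) ≡ nothing
    inner-nkBud v (inner _ _) _ = refl

    nkBud-budOf : ∀ v (k : Kind (at v)) {w} → nkBud (nodeKind v k) ≡ just w →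
                  Σ (Pos t) λ c → BudOf (at v) c × toFin c ≡ w
    nkBud-budOf v (bud c b _) refl = c , b , refl

    open Preproof preproof using () renaming (size to n)

    childLink : ∀ v (i : Fin (arity preproof v)) →
      Σ (Fin (arityAt (at v))) λ j → child preproof v i ≡ toFin (childAt (at v) j)
        × (∀ {τ τ'} → kTrace (kindAt (at v)) j τ τ' → nkTrace (Preproof.kind preproof v) i τ τ')
        × (∀ {τ τ'} → kProg (kindAt (at v)) j τ τ' → nkProg (Preproof.kind preproof v) i τ τ')
    childLink v = nkChild-childAt v (kindAt (at v))

    at-child : ∀ v i → at (child preproof v i) ≡ childAt (at v) (proj₁ (childLink v i))
    at-child v i = trans (cong at (proj₁ (proj₂ (childLink v i)))) (fromFin-toFin _)

    childAt-edge : ∀ p j →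
      Σ (Fin (arity preproof (toFin p))) λ i → child preproof (toFin p) i ≡ toFin (childAt p j)
    childAt-edge p j = reindex (toFin p) j (fromFin-toFin p)
      where
      reindex : ∀ v {q} (j : Fin (arityAt q)) → at v ≡ q →
                Σ (Fin (arity preproof v)) λ i → child preproof v i ≡ toFin (childAt q j)
      reindex v j refl = childAt-nkChild v (kindAt (at v)) j

    parent-child : ∀ v i → parent (at (child preproof v i)) ≡ just (at v , proj₁ (childLink v i))
    parent-child v i = trans (cong parent (at-child v i)) (parent-childAt (at v) _)

    child-injective : ∀ v i i' → child preproof v i ≡ child preproof v i' → i ≡ i'
    child-injective v = sameChild (kindAt (at v))
      where
      sameChild : (k : Kind (at v)) (i i' : Fin (nkArity (nodeKind v k))) →
                  nkChild (nodeKind v k) i ≡ nkChild (nodeKind v k) i' → i ≡ i'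
      sameChild (inner _ _) i i' e
        with just-injective (trans (sym (parent-childAt (at v) i))
               (trans (cong parent (toFin-injective {childAt (at v) i} {childAt (at v) i'} childAt≡))
                      (parent-childAt (at v) i')))
        where
        childAt≡ : toFin (childAt (at v) i) ≡ toFin (childAt (at v) i')
        childAt≡ = trans (sym (lookup∘tabulate (toFin ∘ childAt (at v)) i))
                         (trans e (lookup∘tabulate (toFin ∘ childAt (at v)) i'))
      ... | refl = refl

    wellFormed : WellFormed preproof
    wellFormed = record
      { root-orphan     = λ v i e →
          childAt-not-root (at v) _ (trans (sym (at-child v i)) (trans (cong at e) (fromFin-toFin _)))
      ; has-parent      = hasParent
      ; parent-unique   = parentUnique
      ; rank            = depth ∘ at
      ; rank-child      = λ v i → subst (depth (at v) <_) (cong depth (sym (at-child v i))) (depth-child (at v) _)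
      ; companion-inner = companionInner
      }
      where
      hasParent : ∀ w → w ≢ toFin (root t) → Σ (Fin n) λ v → Σ (Fin (arity preproof v)) λ i → child preproof v i ≡ w
      hasParent w w≢root with rootOrChild (at w)
      ... | inj₁ e = ⊥-elim (w≢root (trans (sym (toFin-fromFin t w)) (cong toFin e)))
      ... | inj₂ ((p , j) , e) with childAt-edge p j
      ...   | i , c≡ = toFin p , i , trans c≡ (trans (cong toFin e) (toFin-fromFin t w))

      parentUnique : ∀ v i v' i' → child preproof v i ≡ child preproof v' i' →
                     _≡_ {A = Σ (Fin n) λ u → Fin (arity preproof u)} (v , i) (v' , i')
      parentUnique v i v' i' e with trans (sym (parent-child v i)) (trans (cong (parent ∘ at) e) (parent-child v' i'))
      ... | slots≡ with trans (sym (toFin-fromFin t v))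
                            (trans (cong (toFin ∘ proj₁) (just-injective slots≡)) (toFin-fromFin t v'))
      ...   | refl = cong (v ,_) (child-injective v i i' e)

      companionInner : ∀ v c → budOf preproof v ≡ just c → budOf preproof c ≡ nothing
      companionInner v c e with nkBud-budOf v (kindAt (at v)) e
      ... | c₀ , b , refl = companion (toFin c₀) (fromFin-toFin c₀)
        where
        companion : ∀ w → at w ≡ c₀ → budOf preproof w ≡ nothing
        companion w refl = inner-nkBud w (kindAt (at w)) (budOf-companion-inner b)

    at-resolve : ∀ v i →
      at (resolve preproof (child preproof v i)) ≡ resolveAt (childAt (at v) (proj₁ (childLink v i)))
    at-resolve v i = trans (cong at (nkResolve-resolveKind w (kindAt (at w))))
                           (trans (fromFin-toFin _) (cong resolveAt (at-child v i)))
      where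
      w : Fin n
      w = child preproof v i

    open LevelCriteria Sg preproof

    globalTrace : GlobalTrace preproof
    globalTrace = globalTrace-by-levels (level ∘ at) (descent ∘ at) (traced ∘ at) (size t)
                    (level-≤-size ∘ at) step
      where
      step : ∀ v i → TraceStep (level ∘ at) (descent ∘ at) (traced ∘ at) v i
      step v i with childLink v i | at-resolve v i
      ... | j , _ , trace⇒ , prog⇒ | at-w≡ with subst (StepTo (at v) j) (sym at-w≡) (traceStep (at v) j)
      ...   | inj₁ rise                           = inj₁ rise
      ...   | inj₂ (same , trace , inj₁ prog)     = inj₂ (same , trace⇒ trace , inj₁ (prog⇒ prog))
      ...   | inj₂ (same , trace , inj₂ lower)    = inj₂ (same , trace⇒ trace , inj₂ lower)

    nonOverlapping : NonOverlapping preproof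
    nonOverlapping = nonOverlapping-by-levels (level ∘ at) level-mono
      λ e e' same same' → just-injective (trans (sym (edge-loopNext e same)) (edge-loopNext e' same'))
      where
      level-mono : ∀ {v w} → Edge preproof v w → level (at v) ≤ level (at w)
      level-mono {v} (inj₁ (i , refl)) = subst (level (at v) ≤_) (cong level (sym (at-child v i))) (level-child (at v) _)
      level-mono {v} (inj₂ e) with nkBud-budOf v (kindAt (at v)) e
      ... | c , b , refl = ≤-reflexive (trans (budOf-level b) (cong level (sym (fromFin-toFin c))))

      edge-loopNext : ∀ {v w} → Edge preproof v w → level (at v) ≡ level (at w) →
                      Maybe.map toFin (loopNext (at v)) ≡ just w
      edge-loopNext {v} (inj₁ (i , refl)) same =
        trans (cong (Maybe.map toFin) (loopNext-child (at v) _ (trans same (cong level (at-child v i)))))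
              (cong just (sym (proj₁ (proj₂ (childLink v i)))))
      edge-loopNext {v} (inj₂ e) _ with nkBud-budOf v (kindAt (at v)) e
      ... | c , b , refl = cong (Maybe.map toFin) (budOf-loopNext b)

    preproof-root : Preproof.seq preproof (Preproof.root preproof) ≡ S
    preproof-root = trans (cong sequentAt (fromFin-toFin (root t))) (sequentAt-root t)

theorem6 : (Sg : Signature) (S : RTC.Sequent Sg) →
    RTC.ProvG Sg S → RTC.ProvNC Sg S
theorem6 Sg S d = preproof t , preproof-root t , wellFormed t , globalTrace t , nonOverlapping t
  where
  open GadgetTrees Sg using (Tree; translate)
  open Assembly Sg
  t : Tree S
  t = translate d
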